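{- Let $(u,v)$ be an unmatched edge that is a bridge with $t(u,v)\le l_m$. Then $t(u)\le t(u,v)$.
   Context: $G=(V,E)$ is a finite undirected graph with a matching $M$, with at least one unmatched vertex. Alternating paths are simple paths alternating between unmatched edges (not in $M$) and matched edges (in $M$), starting with an unmatched edge when starting at an unmatched vertex. $l_m$ is the minimum length of an augmenting path (alternating path between two distinct unmatched vertices), $\infty$ if none. $\mathrm{evenlevel}(v)$, $\mathrm{oddlevel}(v)$ are the minimum lengths of even, resp. odd, alternating paths from an unmatched vertex to $v$ ($\infty$ if none). $\mathrm{minlevel}(v)$ is the smaller of the two, and a $\mathrm{minlevel}(v)$ path is an alternating path from an unmatched vertex to $v$ of length $\mathrm{minlevel}(v)$ (and of the corresponding parity). Tenacity of a vertex: $t(v)=\mathrm{evenlevel}(v)+\mathrm{oddlevel}(v)$; of an unmatched edge $(u,v)$: $\mathrm{evenlevel}(u)+\mathrm{evenlevel}(v)+1$; of a matched edge $(u,v)$: $\mathrm{oddlevel}(u)+\mathrm{oddlevel}(v)+1$. An edge $(u,v)$ is a prop if it is the last edge of some $\mathrm{minlevel}(v)$ path or of some $\mathrm{minlevel}(u)$ path; an edge that is not a prop is a bridge. -}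

module Defs where

open import Data.Nat using (ℕ; zero; suc; _+_; _*_; _≤_)
open import Data.Fin using (Fin)
open import Data.Bool using (Bool; true; false)
open import Data.List using (List; []; _∷_)
open import Data.List.Relation.Unary.Unique.Propositional using (Unique)
open import Data.Product using (Σ; ∃; _×_; _,_)
open import Data.Sum using (_⊎_)
open import Data.Empty using (⊥)
open import Relation.Nullary using (¬_)
open import Relation.Binary.PropositionalEquality using (_≡_)
open import Relation.Binary.Definitions using (Decidable)

data ℕ∞ : Set where
  fin : ℕ → ℕ∞
  ∞   : ℕ∞

infixl 6 _+∞_
_+∞_ : ℕ∞ → ℕ∞ → ℕ∞
fin a +∞ fin b = fin (a + b)
fin _ +∞ ∞     = ∞
∞     +∞ _     = ∞

min∞ : ℕ∞ → ℕ∞ → ℕ∞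
min∞ (fin a) (fin b) = fin (Data.Nat._⊓_ a b)
min∞ (fin a) ∞       = fin a
min∞ ∞       y       = y

infix 4 _≤∞_
data _≤∞_ : ℕ∞ → ℕ∞ → Set where
  fin≤fin : ∀ {a b} → a ≤ b → fin a ≤∞ fin b
  _≤∞∞    : ∀ x → x ≤∞ ∞

IsMin : (ℕ → Set) → ℕ∞ → Set
IsMin P (fin m) = P m × (∀ k → P k → m ≤ k)
IsMin P ∞       = ∀ k → ¬ P k

Even Odd : ℕ → Set
Even k = ∃ λ m → k ≡ 2 * m
Odd  k = ∃ λ m → k ≡ suc (2 * m)

record Graph (n : ℕ) : Set₁ where
  field
    Adj    : Fin n → Fin n → Set
    adj?   : Decidable Adj
    sym    : ∀ {u v} → Adj u v → Adj v u
    irrefl : ∀ {u} → ¬ Adj u u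

record Matching {n : ℕ} (G : Graph n) : Set₁ where
  open Graph G
  field
    M      : Fin n → Fin n → Set
    M?     : Decidable M
    M⊆E    : ∀ {u v} → M u v → Adj u v
    M-sym  : ∀ {u v} → M u v → M v u
    M-func : ∀ {u v w} → M u v → M u w → v ≡ w

module _ {n : ℕ} (G : Graph n) (MM : Matching G) where
  open Graph G
  open Matching MM

  V : Set
  V = Fin n

  Unmatched : V → Set
  Unmatched u = ∀ v → ¬ M u v

  -- Alternating walks.  'AltWalk b x z k': walk from x to z with k edges,
  -- whose next (first) edge must be matched iff b ≡ true, alternating
  -- between unmatched edges (in E, not in M) and matched edges (in M).
  data AltWalk : Bool → V → V → ℕ → Set where
    []      : ∀ {b v} → AltWalk b v v 0
    step-un : ∀ {x y z k} → Adj x y → ¬ M x y →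
              AltWalk true y z k → AltWalk false x z (suc k)
    step-m  : ∀ {x y z k} → M x y →
              AltWalk false y z k → AltWalk true x z (suc k)

  verts : ∀ {b x z k} → AltWalk b x z k → List V
  verts {x = x} []              = x ∷ []
  verts {x = x} (step-un _ _ w) = x ∷ verts w
  verts {x = x} (step-m _ w)    = x ∷ verts w

  data LastEdgeFrom (u : V) : ∀ {b x z k} → AltWalk b x z k → Set where
    here-un  : ∀ {y} (a : Adj u y) (nm : ¬ M u y) →
               LastEdgeFrom u (step-un a nm [])
    here-m   : ∀ {y} (m : M u y) → LastEdgeFrom u (step-m m [])
    there-un : ∀ {x y z k} {a : Adj x y} {nm : ¬ M x y}
               {w : AltWalk true y z k} →
               LastEdgeFrom u w → LastEdgeFrom u (step-un a nm w)
    there-m  : ∀ {x y z k} {m : M x y} {w : AltWalk false y z k} →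
               LastEdgeFrom u w → LastEdgeFrom u (step-m m w)

  record AltPath (s v : V) (k : ℕ) : Set where
    constructor altPath
    field
      walk   : AltWalk false s v k
      simple : Unique (verts walk)

  AltPathTo : V → ℕ → Set
  AltPathTo v k = Σ V λ s → Unmatched s × AltPath s v k

  IsEvenLevel IsOddLevel : V → ℕ∞ → Set
  IsEvenLevel v = IsMin (λ k → Even k × AltPathTo v k)
  IsOddLevel  v = IsMin (λ k → Odd k × AltPathTo v k)

  AugPath : ℕ → Set
  AugPath k = Σ V λ s → Σ V λ t → Unmatched s × Unmatched t × ¬ s ≡ t × AltPath s t k

  IsLm : ℕ∞ → Set
  IsLm = IsMin AugPath

  module Levels (evenlevel oddlevel : V → ℕ∞) where

    minlevel : V → ℕ∞
    minlevel v = min∞ (evenlevel v) (oddlevel v)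

    MinlevelPathLastEdge : V → V → Set
    MinlevelPathLastEdge u v =
      Σ ℕ λ k → (fin k ≡ minlevel v) × Σ V λ s → Unmatched s ×
        Σ (AltPath s v k) λ P → LastEdgeFrom u (AltPath.walk P)

    IsProp IsBridge : V → V → Set
    IsProp u v = MinlevelPathLastEdge u v ⊎ MinlevelPathLastEdge v u
    IsBridge u v = ¬ IsProp u v

    tenacity : V → ℕ∞
    tenacity v = evenlevel v +∞ oddlevel v

    tenacityUnmatchedEdge : V → V → ℕ∞
    tenacityUnmatchedEdge u v = evenlevel u +∞ evenlevel v +∞ fin 1

    tenacityMatchedEdge : V → V → ℕ∞
    tenacityMatchedEdge u v = oddlevel u +∞ oddlevel v +∞ fin 1

-- Since ten(u,v) = evenlevel u + evenlevel v + 1 and ten(u) = evenlevel u + oddlevel u,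
-- it suffices to show oddlevel u ≤ evenlevel v + 1.  Take a shortest even path P to v.
-- If u is not on P, then P followed by (v,u) is an odd path to u.  If P reaches u by an
-- odd prefix, that prefix is one.  Otherwise P = Pre · Suf with Pre even, and Pre followed
-- by (u,v) is an odd path to v; as (u,v) is a bridge this is not a minlevel path, so there
-- is an odd path R to v strictly shorter than Pre.  Cut R where it first meets Suf, at y:
-- depending on the parity there, R's head continues either along Suf back to u (an odd
-- path to u, short enough) or along Suf on to v (an even path to v shorter than P, which
-- is impossible).

module Submission where

open import Defs
open import Data.Bool using (Bool; true; false; not; _xor_)
open import Data.Bool.Properties using (not-involutive; ¬-not) renaming (_≟_ to _≟ᵇ_)
open import Data.Empty using (⊥-elim)
open import Data.Fin using (Fin)
open import Data.Fin.Properties using () renaming (_≟_ to _≟ᶠ_)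
open import Data.List using (List; []; _∷_; _++_; [_]; reverse)
open import Data.List.Properties using (unfold-reverse)
open import Data.List.Membership.Propositional using (_∈_; _∉_; lose)
open import Data.List.Membership.Propositional.Properties using (∈-++⁺ˡ)
open import Data.List.Relation.Binary.Disjoint.Propositional using (Disjoint)
open import Data.List.Relation.Binary.Permutation.Propositional using (↭-sym; ↭⇒↭ₛ)
open import Data.List.Relation.Binary.Permutation.Propositional.Properties using (↭-reverse)
import Data.List.Relation.Binary.Permutation.Setoid.Properties as Permutation
import Data.List.Relation.Unary.All as All
import Data.List.Relation.Unary.All.Properties as All
open import Data.List.Relation.Unary.Any using (Any; here; there)
import Data.List.Relation.Unary.Any.Properties as Any
open import Data.List.Relation.Unary.Unique.Propositional using (Unique; []; _∷_)
import Data.List.Relation.Unary.Unique.Propositional.Properties as Unique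
open import Data.Nat using (ℕ; suc; _+_; _≤_; _<_; z<s)
open import Data.Nat.Properties
open import Data.Product using (∃; Σ-syntax; ∃-syntax; _×_; _,_; proj₁)
open import Data.Sum as Sum using (_⊎_; inj₁; inj₂)
open import Function using (_∘_)
open import Relation.Nullary using (¬_; yes; no)
open import Relation.Binary.PropositionalEquality hiding ([_])

≤∞-trans : ∀ {x y z} → x ≤∞ y → y ≤∞ z → x ≤∞ z
≤∞-trans (fin≤fin p) (fin≤fin q) = fin≤fin (≤-trans p q)
≤∞-trans _           (_ ≤∞∞)     = _ ≤∞∞

≤∞-fin⁻ : ∀ {x k} → x ≤∞ fin k → ∃[ r ] x ≡ fin r × r ≤ k
≤∞-fin⁻ (fin≤fin r≤k) = _ , refl , r≤k

+∞-monoʳ-≤∞ : ∀ x {y z} → y ≤∞ z → x +∞ y ≤∞ x +∞ z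
+∞-monoʳ-≤∞ (fin a) (fin≤fin p) = fin≤fin (+-monoʳ-≤ a p)
+∞-monoʳ-≤∞ (fin a) (_ ≤∞∞)     = _ ≤∞∞
+∞-monoʳ-≤∞ ∞       _           = ∞ ≤∞∞

+∞-assoc : ∀ x y z → x +∞ y +∞ z ≡ x +∞ (y +∞ z)
+∞-assoc (fin a) (fin b) (fin c) = cong fin (+-assoc a b c)
+∞-assoc (fin a) (fin b) ∞       = refl
+∞-assoc (fin a) ∞       z       = refl
+∞-assoc ∞       y       z       = refl

Parity : Bool → ℕ → Set
Parity false = Even
Parity true  = Odd

Parity-suc : ∀ p {k} → Parity p k → Parity (not p) (suc k)
Parity-suc false (m , refl) = m , refl
Parity-suc true  (m , refl) = suc m , sym (*-suc 2 m)

Parity-unique : ∀ {p q k} → Parity p k → Parity q k → p ≡ q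
Parity-unique {false} {false} _        _        = refl
Parity-unique {true}  {true}  _        _        = refl
Parity-unique {false} {true}  (m , eq) (m′ , eq′) =
  ⊥-elim (even≢odd m m′ (trans (sym eq) eq′))
Parity-unique {true}  {false} (m , eq) (m′ , eq′) =
  ⊥-elim (even≢odd m′ m (trans (sym eq′) eq))

Unique-++⁻ : ∀ {A : Set} (xs : List A) {ys} → Unique (xs ++ ys) →
             Unique xs × Unique ys × Disjoint xs ys
Unique-++⁻ []       u          = [] , u , λ { (() , _) }
Unique-++⁻ (x ∷ xs) (x∉ ∷ u) with All.++⁻ xs x∉ | Unique-++⁻ xs u
... | x∉xs , x∉ys | uxs , uys , disjoint =
  x∉xs ∷ uxs , uys ,
  λ { (here refl , q) → All.lookup x∉ys q refl ; (there p , q) → disjoint (p , q) }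

Unique-reverse : ∀ {A : Set} {xs : List A} → Unique xs → Unique (reverse xs)
Unique-reverse {A} {xs} =
  Permutation.Unique-resp-↭ (setoid A) (↭⇒↭ₛ (↭-sym (↭-reverse xs)))

module AlternatingPaths {n : ℕ} (G : Graph n) (MM : Matching G) where
  open Graph G using (Adj; irrefl) renaming (sym to Adj-sym)
  open Matching MM using (M; M-sym)
  open import Data.List.Membership.DecPropositional (_≟ᶠ_ {n}) using (_∈?_)

  variable
    b c d e : Bool
    i k l m r : ℕ
    s t u v x y z : Fin n

  Edge : Bool → Fin n → Fin n → Set
  Edge false x y = Adj x y × ¬ M x y
  Edge true  x y = M x y

  Edge-sym : ∀ b → Edge b x y → Edge b y x
  Edge-sym false (a , nm) = Adj-sym a , nm ∘ M-sym
  Edge-sym true  m        = M-sym m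

  -- 'Walk b e x z k': an alternating walk with k edges whose first edge has polarity b;
  -- e is the polarity an edge appended at z must have (b itself when the walk is empty).
  infixr 5 _◅_
  data Walk : Bool → Bool → Fin n → Fin n → ℕ → Set where
    []  : Walk b b x x 0
    _◅_ : Edge b x y → Walk (not b) e y z k → Walk b e x z (suc k)

  tailVertices : Walk b e x z k → List (Fin n)
  tailVertices []                  = []
  tailVertices (_◅_ {y = y} _ w) = y ∷ tailVertices w

  vertices : Walk b e x z k → List (Fin n)
  vertices {x = x} w = x ∷ tailVertices w

  end∈vertices : (w : Walk b e x z k) → z ∈ vertices w
  end∈vertices []      = here refl
  end∈vertices (_ ◅ w) = there (end∈vertices w)

  walk-parity : Walk b e x z k → Parity (b xor e) k
  walk-parity {false} []      = 0 , refl
  walk-parity {true}  []      = 0 , refl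
  walk-parity {false} {e} (_ ◅ w) =
    subst (λ p → Parity p _) (not-involutive e) (Parity-suc (not e) (walk-parity w))
  walk-parity {true}  {e} (_ ◅ w) = Parity-suc e (walk-parity w)

  infixr 5 _++ʷ_
  _++ʷ_ : Walk b c x y i → Walk c e y z l → Walk b e x z (i + l)
  []      ++ʷ B = B
  (f ◅ A) ++ʷ B = f ◅ (A ++ʷ B)

  tailVertices-++ʷ : (A : Walk b c x y i) (B : Walk c e y z l) →
                     tailVertices (A ++ʷ B) ≡ tailVertices A ++ tailVertices B
  tailVertices-++ʷ []      B = refl
  tailVertices-++ʷ (_ ◅ A) B = cong (_ ∷_) (tailVertices-++ʷ A B)

  ∈-++ʷ⁺ˡ : (A : Walk b c x y i) (B : Walk c e y z l) →
            t ∈ vertices A → t ∈ vertices (A ++ʷ B)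
  ∈-++ʷ⁺ˡ A B p rewrite tailVertices-++ʷ A B = ∈-++⁺ˡ p

  ∈-++ʷ⁺ʳ : (A : Walk b c x y i) (B : Walk c e y z l) →
            t ∈ vertices B → t ∈ vertices (A ++ʷ B)
  ∈-++ʷ⁺ʳ []      B p = p
  ∈-++ʷ⁺ʳ (_ ◅ A) B p = there (∈-++ʷ⁺ʳ A B p)

  Unique-++ʷ⁻ : (A : Walk b c x y i) (B : Walk c e y z l) → Unique (vertices (A ++ʷ B)) →
                Unique (vertices A) × Unique (vertices B) ×
                Disjoint (vertices A) (tailVertices B)
  Unique-++ʷ⁻ {x = x} A B u
    with uA , uB , disjoint ←
           Unique-++⁻ (vertices A) (subst (Unique ∘ (x ∷_)) (tailVertices-++ʷ A B) u)
    = uA , All.¬Any⇒All¬ _ (λ y∈B → disjoint (end∈vertices A , y∈B)) ∷ uB , disjoint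

  Unique-++ʷ⁺ : (A : Walk b c x y i) (B : Walk c e y z l) →
                Unique (vertices A) → Unique (vertices B) →
                (∀ {t} → t ∈ vertices A → t ∈ vertices B → t ≡ y) →
                Unique (vertices (A ++ʷ B))
  Unique-++ʷ⁺ {x = x} A B uA (y∉B ∷ uB) meet =
    subst (Unique ∘ (x ∷_)) (sym (tailVertices-++ʷ A B))
      (Unique.++⁺ uA uB λ { (p , q) → All.lookup y∉B q (sym (meet p (there q))) })

  infixl 5 _▷_
  _▷_ : Walk b c x y k → Edge c y z → Walk b (not c) x z (suc k)
  []      ▷ f = f ◅ []
  (g ◅ w) ▷ f = g ◅ (w ▷ f)

  vertices-▷ : (w : Walk b c x y k) (f : Edge c y z) →
               vertices (w ▷ f) ≡ vertices w ++ [ z ]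
  vertices-▷ []      f = refl
  vertices-▷ {x = x} (_ ◅ w) f = cong (x ∷_) (vertices-▷ w f)

  Unique-▷ : (w : Walk b c x y k) (f : Edge c y z) →
             Unique (vertices w) → z ∉ vertices w → Unique (vertices (w ▷ f))
  Unique-▷ w f u z∉w = subst Unique (sym (vertices-▷ w f))
    (Unique.++⁺ u (All.[] ∷ []) λ { (p , here refl) → z∉w p })

  reverseʷ : Walk b e x z k → Walk (not e) (not b) z x k
  reverseʷ []              = []
  reverseʷ (_◅_ {false} f w) = reverseʷ w ▷ Edge-sym false f
  reverseʷ (_◅_ {true}  f w) = reverseʷ w ▷ Edge-sym true f

  vertices-▷-reverse : ∀ xs (w : Walk b c z y k) (f : Edge c y x) →
                       vertices w ≡ reverse xs → vertices (w ▷ f) ≡ reverse (x ∷ xs)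
  vertices-▷-reverse {x = x} xs w f eq = begin
    vertices (w ▷ f)       ≡⟨ vertices-▷ w f ⟩
    vertices w ++ [ x ]    ≡⟨ cong (_++ [ x ]) eq ⟩
    reverse xs ++ [ x ]    ≡⟨ unfold-reverse x xs ⟨
    reverse (x ∷ xs)       ∎
    where open ≡-Reasoning

  vertices-reverseʷ : (w : Walk b e x z k) → vertices (reverseʷ w) ≡ reverse (vertices w)
  vertices-reverseʷ []                = refl
  vertices-reverseʷ (_◅_ {false} f w) =
    vertices-▷-reverse (vertices w) (reverseʷ w) (Edge-sym false f) (vertices-reverseʷ w)
  vertices-reverseʷ (_◅_ {true}  f w) =
    vertices-▷-reverse (vertices w) (reverseʷ w) (Edge-sym true f) (vertices-reverseʷ w)

  ∈-reverseʷ⁻ : (w : Walk b e x z k) → t ∈ vertices (reverseʷ w) → t ∈ vertices w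
  ∈-reverseʷ⁻ w p = Any.reverse⁻ (subst (_ ∈_) (vertices-reverseʷ w) p)

  Unique-reverseʷ : (w : Walk b e x z k) →
                    Unique (vertices w) → Unique (vertices (reverseʷ w))
  Unique-reverseʷ w u = subst Unique (sym (vertices-reverseʷ w)) (Unique-reverse u)

  data FirstVisit (S : List (Fin n)) {b e x z} : ∀ {k} → Walk b e x z k → Set where
    cut : (A : Walk b c x y i) (B : Walk c e y z l) → y ∈ S →
          (∀ {t} → t ∈ vertices A → t ∈ S → t ≡ y) → FirstVisit S (A ++ʷ B)

  FirstVisit-◅ : ∀ {S} {w : Walk (not b) e y z k} (f : Edge b x y) →
                 x ∉ S → FirstVisit S w → FirstVisit S (f ◅ w)
  FirstVisit-◅ f x∉S (cut A B y∈S first) = cut (f ◅ A) B y∈S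
    λ { (here refl) t∈S → ⊥-elim (x∉S t∈S) ; (there p) t∈S → first p t∈S }

  firstVisit : ∀ S (w : Walk b e x z k) → Any (_∈ S) (vertices w) → FirstVisit S w
  firstVisit S w       (here x∈S) = cut [] w x∈S λ { (here refl) _ → refl }
  firstVisit S []      (there ())
  firstVisit {x = x} S (f ◅ w) (there hit) with x ∈? S
  ... | yes x∈S = cut [] (f ◅ w) x∈S λ { (here refl) _ → refl }
  ... | no  x∉S = FirstVisit-◅ f x∉S (firstVisit S w hit)

  toAltWalk : Walk b e x z k → AltWalk G MM b x z k
  toAltWalk []                       = []
  toAltWalk (_◅_ {false} (a , nm) w) = step-un a nm (toAltWalk w)
  toAltWalk (_◅_ {true}  m w)        = step-m m (toAltWalk w)

  verts-toAltWalk : (w : Walk b e x z k) → verts G MM (toAltWalk w) ≡ vertices w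
  verts-toAltWalk []                = refl
  verts-toAltWalk (_◅_ {false} _ w) = cong (_ ∷_) (verts-toAltWalk w)
  verts-toAltWalk (_◅_ {true}  _ w) = cong (_ ∷_) (verts-toAltWalk w)

  fromAltWalk : (w : AltWalk G MM b x z k) →
                ∃[ e ] Σ[ w′ ∈ Walk b e x z k ] vertices w′ ≡ verts G MM w
  fromAltWalk []                = _ , [] , refl
  fromAltWalk (step-un a nm w) with e , w′ , eq ← fromAltWalk w =
    e , (a , nm) ◅ w′ , cong (_ ∷_) eq
  fromAltWalk (step-m m w)     with e , w′ , eq ← fromAltWalk w =
    e , m ◅ w′ , cong (_ ∷_) eq

  LastEdgeFrom-▷ : (w : Walk b c x y k) (f : Edge c y z) →
                   LastEdgeFrom G MM y (toAltWalk (w ▷ f))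
  LastEdgeFrom-▷ {c = false} []      (a , nm) = here-un a nm
  LastEdgeFrom-▷ {c = true}  []      m        = here-m m
  LastEdgeFrom-▷ (_◅_ {false} _ w) f          = there-un (LastEdgeFrom-▷ w f)
  LastEdgeFrom-▷ (_◅_ {true}  _ w) f          = there-m (LastEdgeFrom-▷ w f)

  -- An alternating path of length k from an unmatched vertex to x; it is odd iff e ≡ true.
  data PathTo (e : Bool) (x : Fin n) (k : ℕ) : Set where
    path : Unmatched G MM s → (w : Walk false e s x k) → Unique (vertices w) → PathTo e x k

  PathTo-parity : PathTo e x k → Parity e k
  PathTo-parity (path _ w _) = walk-parity w

  PathTo⇒AltPathTo : PathTo e x k → AltPathTo G MM x k
  PathTo⇒AltPathTo (path unm w u) =
    _ , unm , altPath (toAltWalk w) (subst Unique (sym (verts-toAltWalk w)) u)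

  AltPathTo⇒PathTo : AltPathTo G MM x k → ∃[ e ] PathTo e x k
  AltPathTo⇒PathTo (_ , unm , altPath w u) with e , w′ , eq ← fromAltWalk w =
    e , path unm w′ (subst Unique (sym eq) u)

  splice : Unmatched G MM s → (A : Walk false c s y i) → Unique (vertices A) →
           (S₁ : Walk b d u y m) (S₂ : Walk d e y v l) →
           Unique (vertices (S₁ ++ʷ S₂)) →
           (∀ {t} → t ∈ vertices A → t ∈ vertices (S₁ ++ʷ S₂) → t ≡ y) →
           PathTo (not b) u (i + m) ⊎ PathTo e v (i + l)
  splice {c = c} {d = d} unm A uA S₁ S₂ uS meet
    with uS₁ , uS₂ , _ ← Unique-++ʷ⁻ S₁ S₂ uS | c ≟ᵇ d
  ... | yes refl = inj₂ (path unm (A ++ʷ S₂)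
          (Unique-++ʷ⁺ A S₂ uA uS₂ λ p q → meet p (∈-++ʷ⁺ʳ S₁ S₂ q)))
  ... | no c≢d with refl ← ¬-not c≢d = inj₁ (path unm (A ++ʷ reverseʷ S₁)
          (Unique-++ʷ⁺ A (reverseʷ S₁) uA (Unique-reverseʷ S₁ uS₁)
             λ p q → meet p (∈-++ʷ⁺ˡ S₁ S₂ (∈-reverseʷ⁻ S₁ q))))

  reroute : PathTo c v r → (S : Walk b e u v l) → Unique (vertices S) →
            (∃[ k ] k ≤ r + l × PathTo (not b) u k) ⊎ (∃[ k ] k ≤ r + l × PathTo e v k)
  reroute (path unm R uR) S uS
    with firstVisit (vertices S) R (lose (end∈vertices R) (end∈vertices S))
  ... | cut {i = i} {l = i′} A B y∈S first with firstVisit [ _ ] S (lose y∈S (here refl))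
  ... | cut {i = m} {l = m′} S₁ S₂ (here refl) _ with uA , _ ← Unique-++ʷ⁻ A B uR =
    Sum.map (λ p → _ , +-mono-≤ (m≤m+n i i′) (m≤m+n m m′) , p)
            (λ p → _ , +-mono-≤ (m≤m+n i i′) (m≤n+m m′ m) , p)
            (splice unm A uA S₁ S₂ uS first)

  module _ (evenlevel oddlevel : Fin n → ℕ∞)
           (isEvenLevel : ∀ x → IsEvenLevel G MM x (evenlevel x))
           (isOddLevel  : ∀ x → IsOddLevel G MM x (oddlevel x)) where
    open Levels G MM evenlevel oddlevel using (minlevel; IsProp; IsBridge)

    level : Bool → Fin n → ℕ∞
    level false = evenlevel
    level true  = oddlevel

    isLevel : ∀ e x → IsMin (λ k → Parity e k × AltPathTo G MM x k) (level e x)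
    isLevel false = isEvenLevel
    isLevel true  = isOddLevel

    level-≤ : PathTo e x k → level e x ≤∞ fin k
    level-≤ {e} {x} {k} p with level e x | isLevel e x
    ... | fin _ | _ , minimal = fin≤fin (minimal k (PathTo-parity p , PathTo⇒AltPathTo p))
    ... | ∞     | none        = ⊥-elim (none k (PathTo-parity p , PathTo⇒AltPathTo p))

    level-path : level e x ≡ fin k → PathTo e x k
    level-path {e} {x} {k} eq
      with (parity , alt) , _ ← subst (IsMin _) eq (isLevel e x)
      with _ , p ← AltPathTo⇒PathTo alt
      = subst (λ c → PathTo c x k) (Parity-unique (PathTo-parity p) parity) p

    ▷-minlevel⇒IsProp : Unmatched G MM s → (w : Walk false c s u k) (f : Edge c u v) →
                        Unique (vertices (w ▷ f)) → minlevel v ≡ fin (suc k) → IsProp u v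
    ▷-minlevel⇒IsProp unm w f uw eq =
      inj₁ (_ , sym eq , _ , unm , altPath (toAltWalk (w ▷ f)) uP , LastEdgeFrom-▷ w f)
      where
      uP = subst Unique (sym (verts-toAltWalk (w ▷ f))) uw

    bridge⇒shorter-odd-path : IsBridge u v → Unmatched G MM s →
                              (w : Walk false false s u i) (f : Edge false u v) →
                              Unique (vertices (w ▷ f)) → evenlevel v ≡ fin k → i < k →
                              ∃[ r ] r < i × PathTo true v r
    bridge⇒shorter-odd-path {v = v} {i = i} bridge unm w f uw eq i<k
      with r , eqo , r≤1+i ← ≤∞-fin⁻ (level-≤ (path unm (w ▷ f) uw))
      with r ≟ suc i
    ... | yes refl = ⊥-elim (bridge (▷-minlevel⇒IsProp unm w f uw minlevel≡))
      where
      minlevel≡ : minlevel v ≡ fin (suc i)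
      minlevel≡ = trans (cong₂ min∞ eq eqo) (cong fin (m≥n⇒m⊓n≡n i<k))
    ... | no r≢1+i = r , ≤∧≢⇒< (m<1+n⇒m≤n (≤∧≢⇒< r≤1+i r≢1+i)) r≢i , R
      where
      R : PathTo true v r
      R = level-path eqo
      r≢i : r ≢ i
      r≢i r≡i with () ← Parity-unique {true} {false}
                          (PathTo-parity R) (subst Even (sym r≡i) (walk-parity w))

    oddlevel≤suc-at-even-cut : IsBridge u v → Edge false u v → Unmatched G MM s →
             (Pre : Walk false false s u i) (Suf : Walk false false u v l) →
             Unique (vertices (Pre ++ʷ Suf)) → evenlevel v ≡ fin (i + l) →
             oddlevel u ≤∞ fin (suc (i + l))
    oddlevel≤suc-at-even-cut _ (a , _) _ _ [] _ _ = ⊥-elim (irrefl a)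
    oddlevel≤suc-at-even-cut {i = i} {l = suc l} bridge f unm Pre Suf@(_ ◅ Suf′) uP eq
      with uPre , uSuf , disjoint ← Unique-++ʷ⁻ Pre Suf uP
      with r , r<i , R ← bridge⇒shorter-odd-path bridge unm Pre f
             (Unique-▷ Pre f uPre λ v∈Pre → disjoint (v∈Pre , end∈vertices Suf′))
             eq (m<m+n i z<s)
      with reroute R Suf uSuf
    ... | inj₁ (k , k≤ , p) =
            ≤∞-trans (level-≤ p)
              (fin≤fin (≤-trans k≤ (≤-trans (+-monoˡ-≤ (suc l) (<⇒≤ r<i)) (n≤1+n _))))
    ... | inj₂ (k , k≤ , p) with fin≤fin i+l≤k ← subst (_≤∞ fin k) eq (level-≤ p) =
            ⊥-elim (<⇒≱ (+-monoˡ-< (suc l) r<i) (≤-trans i+l≤k k≤))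

    bridge⇒oddlevel≤suc : IsBridge u v → Edge false u v → evenlevel v ≡ fin k →
                          oddlevel u ≤∞ fin (suc k)
    bridge⇒oddlevel≤suc {u} bridge f eq
      with path unm P uP ← level-path {false} eq | u ∈? vertices P
    ... | no u∉P = level-≤ (path unm (P ▷ Edge-sym false f) (Unique-▷ P _ uP u∉P))
    ... | yes u∈P with firstVisit [ u ] P (lose u∈P (here refl))
    ... | cut {c = true} {i = i} {l = l} Pre Suf (here refl) _ =
          ≤∞-trans (level-≤ (path unm Pre (proj₁ (Unique-++ʷ⁻ Pre Suf uP))))
                   (fin≤fin (≤-trans (m≤m+n i l) (n≤1+n _)))
    ... | cut {c = false} Pre Suf (here refl) _ =
          oddlevel≤suc-at-even-cut bridge f unm Pre Suf uP eq

    bridge⇒oddlevel≤evenlevel+1 : IsBridge u v → Edge false u v →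
                                  oddlevel u ≤∞ evenlevel v +∞ fin 1
    bridge⇒oddlevel≤evenlevel+1 {u} {v} bridge f = bound (evenlevel v) refl
      where
      bound : ∀ o → evenlevel v ≡ o → oddlevel u ≤∞ o +∞ fin 1
      bound ∞       _  = _ ≤∞∞
      bound (fin k) eq =
        subst (λ j → oddlevel u ≤∞ fin j) (+-comm 1 k) (bridge⇒oddlevel≤suc bridge f eq)

lemma12 : ∀ {n} (G : Graph n) (MM : Matching G) →
    ∃ (λ w → Unmatched G MM w) →
    (evenlevel oddlevel : V G MM → ℕ∞) →
    (∀ x → IsEvenLevel G MM x (evenlevel x)) →
    (∀ x → IsOddLevel G MM x (oddlevel x)) →
    (lm : ℕ∞) → IsLm G MM lm →
    ∀ u v → Graph.Adj G u v → ¬ Matching.M MM u v →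
    Levels.IsBridge G MM evenlevel oddlevel u v →
    Levels.tenacityUnmatchedEdge G MM evenlevel oddlevel u v ≤∞ lm →
    Levels.tenacity G MM evenlevel oddlevel u ≤∞ Levels.tenacityUnmatchedEdge G MM evenlevel oddlevel u v
lemma12 G MM _ evenlevel oddlevel isEvenLevel isOddLevel _ _ u v a nm bridge _ =
  subst (evenlevel u +∞ oddlevel u ≤∞_) (sym (+∞-assoc (evenlevel u) (evenlevel v) (fin 1)))
    (+∞-monoʳ-≤∞ (evenlevel u)
      (AlternatingPaths.bridge⇒oddlevel≤evenlevel+1
         G MM evenlevel oddlevel isEvenLevel isOddLevel bridge (a , nm)))
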